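{- Work in the theory $\mathsf{SB}$ described in the context, and let $\mathsf H$ be the formula defined there. Then $\mathsf{SB}$ proves that $\mathsf H$ is surjective: for every $y$ with $\mathsf B y$ there is an $x$ with $x\mathrel{\mathsf H}y$.
   Context: The theory $\mathsf{ac}$ (adjunctive class theory) is two-sorted, with a sort of objects (variables $x,y,\dots$) and a sort of classes (variables $X,Y,\dots$), identity on each sort, and a membership relation $\in$ between objects and classes, with axioms: there is a class with no members; for every class $Y$ and object $y$ there is a class $X$ with $\forall x\,(x\in X\leftrightarrow (x\in Y\vee x=y))$; classes with the same members are equal. The theory $\mathsf{SB}$ is $\mathsf{ac}$ extended with unary predicates $\mathsf A,\mathsf B$ on objects and binary predicates $\mathsf E_{\mathsf A},\mathsf E_{\mathsf B},\mathsf F,\mathsf G$ on objects, with axioms stating: $\mathsf E_{\mathsf A}$ is an equivalence relation on $\{x\mid \mathsf A x\}$; $\mathsf E_{\mathsf B}$ is an equivalence relation on $\{y\mid\mathsf B y\}$; $\mathsf F$ is an injection from $\mathsf A/\mathsf E_{\mathsf A}$ to $\mathsf B/\mathsf E_{\mathsf B}$; $\mathsf G$ is an injection from $\mathsf B/\mathsf E_{\mathsf B}$ to $\mathsf A/\mathsf E_{\mathsf A}$. Here "$\mathsf F$ is an injection from $\mathsf A/\mathsf E_{\mathsf A}$ to $\mathsf B/\mathsf E_{\mathsf B}$" means: $x\mathrel{\mathsf F}y$ implies $\mathsf A x$ and $\mathsf B y$; if $x\,\mathsf E_{\mathsf A}\,x'\mathrel{\mathsf F}y'\,\mathsf E_{\mathsf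 B}\,y$ then $x\mathrel{\mathsf F}y$; every $x\in\mathsf A$ has some $y$ with $x\mathrel{\mathsf F}y$; $x\mathrel{\mathsf F}y$ and $x\mathrel{\mathsf F}y'$ imply $y\,\mathsf E_{\mathsf B}\,y'$; $x\mathrel{\mathsf F}y$ and $x'\mathrel{\mathsf F}y$ imply $x\,\mathsf E_{\mathsf A}\,x'$. Similarly for $\mathsf G$ with the roles of $\mathsf A,\mathsf B$ swapped. A pair of classes $(X,Y)$ is downwards closed if $X\subseteq\mathsf A$, $Y\subseteq \mathsf B$, whenever $v\mathrel{\mathsf G}u$ and $u\in X$ there is $v'\in Y$ with $v'\mathrel{\mathsf G}u$, and whenever $u\mathrel{\mathsf F}v$ and $v\in Y$ there is $u'\in X$ with $u'\mathrel{\mathsf F}v$. $(X,Y)$ is an $x$-switch if it is downwards closed, $x\in X$, and every member of $X$ is in the range of $\mathsf G$. Define $x\mathrel{\mathsf H}y$ iff (there is no $x$-switch and $x\mathrel{\mathsf F}y$) or (there is an $x$-switch and $y\mathrel{\mathsf G}x$). -}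

module Defs where

open import Data.Product using (Σ; ∃; _×_; _,_)
open import Data.Sum using (_⊎_)
open import Relation.Nullary using (¬_)
open import Relation.Binary.PropositionalEquality using (_≡_)
open import Function.Bundles using (_⇔_)

-- A (set-valued) model of the theory SB.  Identity on each sort is
-- interpreted by propositional equality.
record SBModel : Set₁ where
  field
    Obj   : Set
    Cls   : Set
    _∈_   : Obj → Cls → Set
    empty  : Σ Cls λ X → ∀ x → ¬ (x ∈ X)
    adjoin : ∀ (Y : Cls) (y : Obj) → Σ Cls λ X → ∀ x → (x ∈ X) ⇔ ((x ∈ Y) ⊎ (x ≡ y))
    ext    : ∀ (X Y : Cls) → (∀ x → (x ∈ X) ⇔ (x ∈ Y)) → X ≡ Y
    A B : Obj → Set
    EA EB F G : Obj → Obj → Set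
    EA-dom   : ∀ {x x'} → EA x x' → A x × A x'
    EA-refl  : ∀ {x} → A x → EA x x
    EA-sym   : ∀ {x x'} → EA x x' → EA x' x
    EA-trans : ∀ {x x' x''} → EA x x' → EA x' x'' → EA x x''
    EB-dom   : ∀ {y y'} → EB y y' → B y × B y'
    EB-refl  : ∀ {y} → B y → EB y y
    EB-sym   : ∀ {y y'} → EB y y' → EB y' y
    EB-trans : ∀ {y y' y''} → EB y y' → EB y' y'' → EB y y''
    -- F is an injection from A/E_A to B/E_B
    F-dom   : ∀ {x y} → F x y → A x × B y
    F-resp  : ∀ {x x' y' y} → EA x x' → F x' y' → EB y' y → F x y
    F-total : ∀ {x} → A x → ∃ λ y → F x y
    F-func  : ∀ {x y y'} → F x y → F x y' → EB y y'
    F-inj   : ∀ {x x' y} → F x y → F x' y → EA x x'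
    -- G is an injection from B/E_B to A/E_A
    G-dom   : ∀ {y x} → G y x → B y × A x
    G-resp  : ∀ {y y' x' x} → EB y y' → G y' x' → EA x' x → G y x
    G-total : ∀ {y} → B y → ∃ λ x → G y x
    G-func  : ∀ {y x x'} → G y x → G y x' → EA x x'
    G-inj   : ∀ {y y' x} → G y x → G y' x → EB y y'

module _ (M : SBModel) where
  open SBModel M

  DownwardsClosed : Cls → Cls → Set
  DownwardsClosed X Y =
      (∀ u → u ∈ X → A u)
    × (∀ v → v ∈ Y → B v)
    × (∀ v u → G v u → u ∈ X → Σ Obj λ v' → (v' ∈ Y) × G v' u)
    × (∀ u v → F u v → v ∈ Y → Σ Obj λ u' → (u' ∈ X) × F u' v)

  IsSwitch : Obj → Cls → Cls → Set
  IsSwitch x X Y =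
      DownwardsClosed X Y
    × (x ∈ X)
    × (∀ u → u ∈ X → Σ Obj λ v → G v u)

  HasSwitch : Obj → Set
  HasSwitch x = Σ Cls λ X → Σ Cls λ Y → IsSwitch x X Y

  H : Obj → Obj → Set
  H x y = (¬ HasSwitch x × F x y) ⊎ (HasSwitch x × G y x)

-- Pick x with y G x. If x has a switch then x H y. Otherwise y has an
-- F-preimage x', since else ({x}, {y}) would be an x-switch; and x' has no
-- switch, since adding x and y to an x'-switch would give an x-switch.
-- Hence x' H y.
module Submission where

open import Defs
open import Level using (0ℓ)
open import Data.Product using (∃; Σ; _×_; _,_; proj₁; proj₂)
open import Data.Sum using (_⊎_; inj₁; inj₂)
open import Data.Empty using (⊥-elim)
open import Relation.Nullary using (¬_; yes; no)
open import Relation.Binary.PropositionalEquality using (_≡_; refl)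
open import Function.Bundles using (Equivalence)
open import Axiom.ExcludedMiddle using (ExcludedMiddle)

module SwitchConstruction (M : SBModel) where
  open SBModel M

  ∅ : Cls
  ∅ = proj₁ empty

  ∉-∅ : ∀ u → ¬ (u ∈ ∅)
  ∉-∅ = proj₂ empty

  insert : Obj → Cls → Cls
  insert x X = proj₁ (adjoin X x)

  ∈-insert⁻ : ∀ {u x X} → u ∈ insert x X → (u ∈ X) ⊎ (u ≡ x)
  ∈-insert⁻ {u} {x} {X} = Equivalence.to (proj₂ (adjoin X x) u)

  ∈-insert⁺ : ∀ {u x X} → (u ∈ X) ⊎ (u ≡ x) → u ∈ insert x X
  ∈-insert⁺ {u} {x} {X} = Equivalence.from (proj₂ (adjoin X x) u)

  InRangeOfG : Cls → Set
  InRangeOfG X = ∀ u → u ∈ X → Σ Obj λ v → G v u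

  FPreimagesMeet : Cls → Obj → Set
  FPreimagesMeet X y = ∀ u → F u y → Σ Obj λ u' → (u' ∈ X) × F u' y

  ∅-downwardsClosed : DownwardsClosed M ∅ ∅
  ∅-downwardsClosed =
      (λ u m → ⊥-elim (∉-∅ u m))
    , (λ v m → ⊥-elim (∉-∅ v m))
    , (λ v u g m → ⊥-elim (∉-∅ u m))
    , (λ u v f m → ⊥-elim (∉-∅ v m))

  ∅-inRangeOfG : InRangeOfG ∅
  ∅-inRangeOfG u m = ⊥-elim (∉-∅ u m)

  insert-downwardsClosed : ∀ {X Y x y} → DownwardsClosed M X Y → G y x →
    FPreimagesMeet X y → DownwardsClosed M (insert x X) (insert y Y)
  insert-downwardsClosed {X} {Y} {x} {y} (X⊆A , Y⊆B , closedG , closedF) gyx meet =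
    X'⊆A , Y'⊆B , closedG' , closedF'
    where
    X'⊆A : ∀ u → u ∈ insert x X → A u
    X'⊆A u m with ∈-insert⁻ m
    ... | inj₁ u∈X = X⊆A u u∈X
    ... | inj₂ refl = proj₂ (G-dom gyx)

    Y'⊆B : ∀ v → v ∈ insert y Y → B v
    Y'⊆B v m with ∈-insert⁻ m
    ... | inj₁ v∈Y = Y⊆B v v∈Y
    ... | inj₂ refl = proj₁ (G-dom gyx)

    closedG' : ∀ v u → G v u → u ∈ insert x X → Σ Obj λ v' → (v' ∈ insert y Y) × G v' u
    closedG' v u g m with ∈-insert⁻ m
    ... | inj₁ u∈X = let (v' , v'∈Y , g') = closedG v u g u∈X in v' , ∈-insert⁺ (inj₁ v'∈Y) , g'
    ... | inj₂ refl = y , ∈-insert⁺ (inj₂ refl) , gyx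

    closedF' : ∀ u v → F u v → v ∈ insert y Y → Σ Obj λ u' → (u' ∈ insert x X) × F u' v
    closedF' u v f m with ∈-insert⁻ m
    ... | inj₁ v∈Y = let (u' , u'∈X , f') = closedF u v f v∈Y in u' , ∈-insert⁺ (inj₁ u'∈X) , f'
    ... | inj₂ refl = let (u' , u'∈X , f') = meet u f in u' , ∈-insert⁺ (inj₁ u'∈X) , f'

  insert-inRangeOfG : ∀ {X x y} → InRangeOfG X → G y x → InRangeOfG (insert x X)
  insert-inRangeOfG rangeX gyx u m with ∈-insert⁻ m
  ... | inj₁ u∈X = rangeX u u∈X
  ... | inj₂ refl = _ , gyx

  insert-hasSwitch : ∀ {X Y x y} → DownwardsClosed M X Y → InRangeOfG X → G y x →
    FPreimagesMeet X y → HasSwitch M x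
  insert-hasSwitch {X} {Y} {x} {y} closed rangeX gyx meet =
    insert x X , insert y Y ,
    insert-downwardsClosed closed gyx meet , ∈-insert⁺ (inj₂ refl) , insert-inRangeOfG rangeX gyx

  hasSwitch-if-no-F-preimage : ∀ {x y} → G y x → ¬ (∃ λ u → F u y) → HasSwitch M x
  hasSwitch-if-no-F-preimage gyx noPreimage =
    insert-hasSwitch ∅-downwardsClosed ∅-inRangeOfG gyx (λ u f → ⊥-elim (noPreimage (u , f)))

  hasSwitch-if-F-preimage-hasSwitch : ∀ {x x' y} → G y x → F x' y → HasSwitch M x' → HasSwitch M x
  hasSwitch-if-F-preimage-hasSwitch gyx fx'y (X , Y , closed , x'∈X , rangeX) =
    insert-hasSwitch closed rangeX gyx (λ _ _ → _ , x'∈X , fx'y)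

open SwitchConstruction

lemma4p3 : ExcludedMiddle 0ℓ → (M : SBModel) → ∀ y → SBModel.B M y → ∃ λ x → H M x y
lemma4p3 em M y By with SBModel.G-total M By
... | x , gyx with em {HasSwitch M x}
... | yes switch = x , inj₂ (switch , gyx)
... | no noSwitch with em {∃ λ u → SBModel.F M u y}
...   | no noPreimage = ⊥-elim (noSwitch (hasSwitch-if-no-F-preimage M gyx noPreimage))
...   | yes (x' , fx'y) with em {HasSwitch M x'}
...     | no noSwitch' = x' , inj₁ (noSwitch' , fx'y)
...     | yes switch' = ⊥-elim (noSwitch (hasSwitch-if-F-preimage-hasSwitch M gyx fx'y switch'))
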